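{- Let $\ell$ and $g$ be positive integers with $g\geq 2\ell-1$. Let $G$ be a multigraph of diameter strictly less than $g/2$ such that every cycle of $G$ has length either $<\ell$ or $>g$. Then every cycle of $G$ has length $<\ell$.
   Context: Multigraphs are finite and may have parallel edges; the diameter is the maximum distance between two vertices (in particular finite diameter means $G$ is connected). The length of a cycle is its number of edges. -}

module Defs where

open import Data.Nat using (ℕ; zero; suc; _+_; _≤_; _<_)
open import Data.Fin using (Fin; zero; suc; inject₁; fromℕ)
open import Data.Product using (Σ; _×_; _,_; ∃-syntax)
open import Data.Sum using (_⊎_)
open import Relation.Binary.PropositionalEquality using (_≡_; _≢_)
open import Function.Definitions using (Injective)

-- A finite multigraph: vertices Fin n, edges Fin m, each edge has two
-- (distinct) endpoints; parallel edges are allowed, loops are not.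
record Multigraph : Set where
  field
    n     : ℕ
    m     : ℕ
    end₁  : Fin m → Fin n
    end₂  : Fin m → Fin n
    noLoop : ∀ e → end₁ e ≢ end₂ e

module _ (G : Multigraph) where
  open Multigraph G

  Joins : Fin m → Fin n → Fin n → Set
  Joins e u v = (end₁ e ≡ u × end₂ e ≡ v) ⊎ (end₁ e ≡ v × end₂ e ≡ u)

  Adjacent : Fin n → Fin n → Set
  Adjacent u v = ∃[ e ] Joins e u v

  data Walk : Fin n → Fin n → ℕ → Set where
    here : ∀ {u} → Walk u u 0
    step : ∀ {u w v d} → Adjacent u w → Walk w v d → Walk u v (suc d)

  record Cycle (k : ℕ) : Set where
    field
      pos      : 1 ≤ k
      vert     : Fin (suc k) → Fin n
      edge     : Fin k → Fin m
      closed   : vert zero ≡ vert (fromℕ k)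
      vertInj  : Injective _≡_ _≡_ (λ (i : Fin k) → vert (inject₁ i))
      edgeInj  : Injective _≡_ _≡_ edge
      edgeJoin : ∀ (i : Fin k) → Joins (edge i) (vert (inject₁ i)) (vert (suc i))

  -- "diameter < g/2": every pair of vertices is joined by a walk of
  -- length d with 2d < g (so dist(u,v) < g/2 for all u, v; includes connectivity)
  DiameterLessThanHalf : ℕ → Set
  DiameterLessThanHalf g = ∀ (u v : Fin n) → ∃[ d ] (Walk u v d × d + d < g)

-- Let C be a cycle of length k > g, with k minimal, and let j = ⌊k/2⌋. The vertices at
-- positions 0 and j of C are joined by a walk of length d < g/2, which shortens to a path of
-- length at most d < j. Cut this path at its successive visits to C into ears. If no ear were
-- shorter than both arcs of C between its ends, the triangle inequality along C would force the
-- path to have length at least the distance j between positions 0 and j on C. So some ear of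
-- length s is shorter than both arcs; as the two arcs have total length k ≥ 2ℓ, one of them has
-- length at least ℓ and closes up with the ear to a cycle of length in [ℓ, k). By hypothesis that
-- cycle is longer than g, contradicting the minimality of k.

module Submission where

open import Defs
open import Data.Empty using (⊥; ⊥-elim)
open import Data.Fin using (Fin; zero; suc; toℕ; inject₁; fromℕ)
import Data.Fin.Properties as Finₚ
open import Data.List using (_∷_; [])
open import Data.Nat using (ℕ; zero; suc; _+_; _*_; _∸_; _≤_; _<_; z≤n; s≤s; s≤s⁻¹; _≤?_; _<?_; ⌊_/2⌋)
open import Data.Nat.Induction using (<-wellFounded)
open import Data.Nat.Properties
open import Data.Nat.Tactic.RingSolver using (solve)
open import Data.Product using (Σ-syntax; ∃-syntax; _×_; _,_; proj₁)
open import Data.Sum using (_⊎_; inj₁; inj₂)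
open import Function using (_∘_)
open import Induction.WellFounded using (Acc; acc)
open import Relation.Binary using (DecidableEquality; tri<; tri≈; tri>)
open import Relation.Binary.PropositionalEquality
open import Relation.Nullary using (¬_; Dec; yes; no; contradiction)
open import Relation.Nullary.Decidable using (_×-dec_)
open import Relation.Unary using (Decidable)

private
  variable
    A : Set
    a b c d g i j k k′ ℓ r s t u : ℕ

-- Sequences indexed by ℕ

append : ℕ → (ℕ → A) → (ℕ → A) → ℕ → A
append b f g i with i <? b
... | yes _ = f i
... | no  _ = g (i ∸ b)

append-< : (f g : ℕ → A) → i < b → append b f g i ≡ f i
append-< {i = i} {b = b} f g i<b with i <? b
... | yes _   = refl
... | no  i≮b = contradiction i<b i≮b

append-+ : ∀ b (f g : ℕ → A) t → append b f g (b + t) ≡ g t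
append-+ b f g t with b + t <? b
... | yes b+t<b = contradiction b+t<b (m+n≮m b t)
... | no  _     = cong g (m+n∸m≡n b t)

data Split (b : ℕ) : ℕ → Set where
  below : i < b → Split b i
  above : ∀ t → Split b (b + t)

split : ∀ b i → Split b i
split b i with i <? b
... | yes i<b = below i<b
... | no  i≮b = subst (Split b) (m+[n∸m]≡n (≮⇒≥ i≮b)) (above (i ∸ b))

Injective< : (ℕ → A) → ℕ → Set
Injective< f k = ∀ {i j} → i < k → j < k → f i ≡ f j → i ≡ j

-- On a cycle of length c + t, rotation c t re-indexes the cycle to start at position c.
rotation : ℕ → ℕ → (ℕ → A) → ℕ → A
rotation c t f = append t (λ i → f (c + i)) f

module _ {c t} (f : ℕ → A) (injective : Injective< f (c + t)) where

  rotation-wrap : i < t → t + j < c + t → rotation c t f i ≢ rotation c t f (t + j)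
  rotation-wrap {i} {j} i<t t+j<c+t eq = m+n≮m c i (subst (_< c) (sym c+i≡j) j<c)
    where
    j<c : j < c
    j<c = +-cancelʳ-< t j c (subst (_< c + t) (+-comm t j) t+j<c+t)
    c+i≡j : c + i ≡ j
    c+i≡j = injective (+-monoʳ-< c i<t) (<-≤-trans j<c (m≤m+n c t))
                      (trans (sym (append-< _ f i<t)) (trans eq (append-+ t _ f j)))

  rotation-injective : Injective< (rotation c t f) (c + t)
  rotation-injective {i} {j} i< j< eq with split t i | split t j
  ... | below i<t | below j<t = +-cancelˡ-≡ c _ _ (injective (+-monoʳ-< c i<t) (+-monoʳ-< c j<t)
                                  (trans (sym (append-< _ f i<t)) (trans eq (append-< _ f j<t))))
  ... | below i<t | above j′  = contradiction eq (rotation-wrap i<t j<)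
  ... | above i′  | below j<t = contradiction (sym eq) (rotation-wrap j<t i<)
  ... | above i′  | above j′  = cong (t +_) (injective (≤-<-trans (m≤n+m i′ t) i<) (≤-<-trans (m≤n+m j′ t) j<)
                                  (trans (sym (append-+ t _ f i′)) (trans eq (append-+ t _ f j′))))

Repetition : (ℕ → A) → ℕ → Set
Repetition f r = ∃[ u ] (u < r × ∃[ t ] (t < u × f t ≡ f u))

repetition? : DecidableEquality A → (f : ℕ → A) → ∀ r → Dec (Repetition f r)
repetition? _≟_ f = anyUpTo? (λ u → anyUpTo? (λ t → f t ≟ f u) u)

¬repetition⇒injective : (f : ℕ → A) → ¬ Repetition f r → Injective< f r
¬repetition⇒injective f none {i} {j} i<r j<r fi≡fj with <-cmp i j
... | tri< i<j _ _ = contradiction (j , j<r , i , i<j , fi≡fj) none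
... | tri≈ _ i≡j _ = i≡j
... | tri> _ _ j<i = contradiction (i , i<r , j , j<i , sym fi≡fj) none

module _ {P : ℕ → Set} (P? : Decidable P) where

  least : ∀ n → ∃[ t ] (t < n × P t) → ∃[ u ] (u < n × P u × (∀ {t} → t < u → ¬ P t))
  least (suc n) w with anyUpTo? P? n
  ... | yes w′ with least n w′
  ...   | u , u<n , Pu , minimal = u , m<n⇒m<1+n u<n , Pu , minimal
  least (suc n) (t , t<1+n , Pt) | no none with m<1+n⇒m<n∨m≡n t<1+n
  ... | inj₁ t<n  = contradiction (t , t<n , Pt) none
  ... | inj₂ refl = t , ≤-refl , Pt , λ u<t Pu → none (_ , u<t , Pu)

clamp : ∀ k → ℕ → Fin (suc k)
clamp k       zero    = zero
clamp zero    (suc i) = zero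
clamp (suc k) (suc i) = suc (clamp k i)

toℕ-clamp : i ≤ k → toℕ (clamp k i) ≡ i
toℕ-clamp z≤n       = refl
toℕ-clamp (s≤s i≤k) = cong suc (toℕ-clamp i≤k)

clamp-injective : i ≤ k → j ≤ k → clamp k i ≡ clamp k j → i ≡ j
clamp-injective i≤k j≤k eq = trans (sym (toℕ-clamp i≤k)) (trans (cong toℕ eq) (toℕ-clamp j≤k))

inject₁-clamp : i ≤ k → inject₁ (clamp k i) ≡ clamp (suc k) i
inject₁-clamp z≤n       = refl
inject₁-clamp (s≤s i≤k) = cong suc (inject₁-clamp i≤k)

clamp-self : ∀ k → clamp k k ≡ fromℕ k
clamp-self zero    = refl
clamp-self (suc k) = cong suc (clamp-self k)

-- Positions on a cycle of length k

m+m<n⇒m<⌊1+n/2⌋ : d + d < k → d < ⌊ suc k /2⌋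
m+m<n⇒m<⌊1+n/2⌋ {d} {k} d+d<k =
  subst (_≤ ⌊ suc k /2⌋) (sym (n≡⌊n+n/2⌋ (suc d))) (⌊n/2⌋-mono (subst (_≤ suc k) (sym (+-suc (suc d) d)) (s≤s d+d<k)))

⌊n/2⌋+⌊n/2⌋≤n : ∀ n → ⌊ n /2⌋ + ⌊ n /2⌋ ≤ n
⌊n/2⌋+⌊n/2⌋≤n n = ≤-trans (+-monoʳ-≤ ⌊ n /2⌋ (⌊n/2⌋≤⌈n/2⌉ n)) (≤-reflexive (⌊n/2⌋+⌈n/2⌉≡n n))

m<n⇒∃[o]0<o×m+o≡n : a < b → ∃[ c ] (0 < c × a + c ≡ b)
m<n⇒∃[o]0<o×m+o≡n {a} a<b with m≤n⇒∃[o]m+o≡n a<b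
... | c , 1+a+c≡b = suc c , s≤s z≤n , trans (+-suc a c) 1+a+c≡b

-- An ear of length s joining positions a < b is shorter than both arcs between them,
-- of lengths b − a and k − (b − a).
Shortcut : ℕ → ℕ → ℕ → ℕ → Set
Shortcut k s a b = s + a < b × s + b < a + k

shortcut? : ∀ k s a b → Dec (Shortcut k s a b)
shortcut? k s a b = (s + a <? b) ×-dec (s + b <? a + k)

shortcut-arcs : a + d ≡ b → b + t ≡ k → Shortcut k s a b →
                (s < d × d + s < k) × (s < t + a × t + a + s < k)
shortcut-arcs {a} {d} {t = t} {s = s} refl refl (s+a<a+d , s+a+d<a+a+d+t) =
  (s<d , d+s<k) , (s<t+a , t+a+s<k)
  where
  open ≤-Reasoning
  s<d : s < d
  s<d = +-cancelˡ-< a s d (subst (_< a + d) (+-comm s a) s+a<a+d)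
  d+s<k : d + s < a + d + t
  d+s<k = +-cancelˡ-< a (d + s) (a + d + t) (begin-strict
    a + (d + s)      ≡⟨ solve (a ∷ d ∷ s ∷ []) ⟩
    s + (a + d)      <⟨ s+a+d<a+a+d+t ⟩
    a + (a + d + t)  ∎)
  s<t+a : s < t + a
  s<t+a = +-cancelʳ-< d s (t + a) (begin-strict
    s + d      ≡⟨ +-comm s d ⟩
    d + s      <⟨ d+s<k ⟩
    a + d + t  ≡⟨ solve (a ∷ d ∷ t ∷ []) ⟩
    t + a + d  ∎)
  t+a+s<k : t + a + s < a + d + t
  t+a+s<k = begin-strict
    t + a + s    ≡⟨ solve (t ∷ a ∷ s ∷ []) ⟩
    t + (s + a)  <⟨ +-monoʳ-< t s+a<a+d ⟩
    t + (a + d)  ≡⟨ +-comm t (a + d) ⟩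
    a + d + t    ∎

long-arc : ℓ + ℓ ≤ a + d + t → d < ℓ → ℓ ≤ t + a
long-arc {ℓ} {a} {d} {t} ℓ+ℓ≤k d<ℓ = <⇒≤ (+-cancelʳ-< ℓ ℓ (t + a) (begin-strict
  ℓ + ℓ        ≤⟨ ℓ+ℓ≤k ⟩
  a + d + t    <⟨ +-monoˡ-< t (+-monoʳ-< a d<ℓ) ⟩
  a + ℓ + t    ≡⟨ solve (a ∷ ℓ ∷ t ∷ []) ⟩
  t + a + ℓ    ∎))
  where open ≤-Reasoning

-- dist(0, a) + r < j, where dist(0, a) = min(a, k − a) is the distance along the cycle.
Lagging : ℕ → ℕ → ℕ → ℕ → Set
Lagging k j a r = a + r < j ⊎ k + r < a + j

-- An ear of length s that is no shortcut moves at most s along the cycle.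
lagging-step : a < k → ¬ Shortcut k s a b → ¬ Shortcut k s b a →
               Lagging k j a (s + r) → Lagging k j b r
lagging-step {a} {k} {s} {b} {j} {r} _ ¬ab _ (inj₁ h) with b ≤? s + a
... | yes b≤s+a = inj₁ (begin-strict
  b + r        ≤⟨ +-monoˡ-≤ r b≤s+a ⟩
  s + a + r    ≡⟨ solve (s ∷ a ∷ r ∷ []) ⟩
  a + (s + r)  <⟨ h ⟩
  j            ∎)
  where open ≤-Reasoning
... | no b≰s+a = inj₂ (begin-strict
  k + r        ≤⟨ m≤n+m (k + r) a ⟩
  a + (k + r)  ≡⟨ sym (+-assoc a k r) ⟩
  a + k + r    ≤⟨ +-monoˡ-≤ r a+k≤s+b ⟩
  s + b + r    ≡⟨ solve (s ∷ b ∷ r ∷ []) ⟩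
  b + (s + r)  <⟨ +-monoʳ-< b (≤-<-trans (m≤n+m (s + r) a) h) ⟩
  b + j        ∎)
  where
  open ≤-Reasoning
  a+k≤s+b : a + k ≤ s + b
  a+k≤s+b = ≮⇒≥ λ s+b<a+k → ¬ab (≰⇒> b≰s+a , s+b<a+k)
lagging-step {a} {k} {s} {b} {j} {r} a<k _ ¬ba (inj₂ h) with a ≤? s + b
... | yes a≤s+b = inj₂ (+-cancelˡ-< s (k + r) (b + j) (begin-strict
  s + (k + r)  ≡⟨ solve (s ∷ k ∷ r ∷ []) ⟩
  k + (s + r)  <⟨ h ⟩
  a + j        ≤⟨ +-monoˡ-≤ j a≤s+b ⟩
  s + b + j    ≡⟨ +-assoc s b j ⟩
  s + (b + j)  ∎))
  where open ≤-Reasoning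
... | no a≰s+b = inj₁ (+-cancelʳ-< (k + k) (b + r) j (begin-strict
  b + r + (k + k)    ≡⟨ solve (b ∷ r ∷ k ∷ []) ⟩
  b + k + (r + k)    ≤⟨ +-monoˡ-≤ (r + k) b+k≤s+a ⟩
  s + a + (r + k)    ≡⟨ solve (s ∷ a ∷ r ∷ k ∷ []) ⟩
  a + (k + (s + r))  <⟨ +-monoʳ-< a h ⟩
  a + (a + j)        ≤⟨ +-monoʳ-≤ a (+-monoˡ-≤ j (<⇒≤ a<k)) ⟩
  a + (k + j)        ≤⟨ +-monoˡ-≤ (k + j) (<⇒≤ a<k) ⟩
  k + (k + j)        ≡⟨ solve (k ∷ j ∷ []) ⟩
  j + (k + k)        ∎))
  where
  open ≤-Reasoning
  b+k≤s+a : b + k ≤ s + a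
  b+k≤s+a = ≮⇒≥ λ s+a<b+k → ¬ba (≰⇒> a≰s+b , s+a<b+k)

¬lagging-at-target : j + j ≤ k → ¬ Lagging k j j 0
¬lagging-at-target {j} _     (inj₁ j+0<j) = <-irrefl (+-identityʳ j) j+0<j
¬lagging-at-target {j} j+j≤k (inj₂ k+0<j+j) = <-irrefl (+-identityʳ _) (<-≤-trans k+0<j+j j+j≤k)

-- Walks, paths and cycles as sequences

module _ (G : Multigraph) where
  open Multigraph G

  private
    variable
      x y z x′ y′ : Fin n
      e e′ : Fin m

  joins-sym : Joins G e x y → Joins G e y x
  joins-sym (inj₁ (p , q)) = inj₂ (p , q)
  joins-sym (inj₂ (p , q)) = inj₁ (p , q)

  joins-unique : Joins G e x y → Joins G e x′ y′ → (x ≡ x′ × y ≡ y′) ⊎ (x ≡ y′ × y ≡ x′)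
  joins-unique (inj₁ (p , q)) (inj₁ (p′ , q′)) = inj₁ (trans (sym p) p′ , trans (sym q) q′)
  joins-unique (inj₁ (p , q)) (inj₂ (p′ , q′)) = inj₂ (trans (sym p) p′ , trans (sym q) q′)
  joins-unique (inj₂ (p , q)) (inj₁ (p′ , q′)) = inj₂ (trans (sym q) q′ , trans (sym p) p′)
  joins-unique (inj₂ (p , q)) (inj₂ (p′ , q′)) = inj₁ (trans (sym q) q′ , trans (sym p) p′)

  joins-resp : e ≡ e′ → x ≡ x′ → y ≡ y′ → Joins G e′ x′ y′ → Joins G e x y
  joins-resp refl refl refl j = j

  record WalkSeq (x y : Fin n) (r : ℕ) : Set where
    field
      vertex : ℕ → Fin n
      edge   : ℕ → Fin m
      start  : vertex 0 ≡ x
      finish : vertex r ≡ y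
      joins  : ∀ {t} → t < r → Joins G (edge t) (vertex t) (vertex (suc t))

  IsPath : WalkSeq x y r → Set
  IsPath {r = r} W = Injective< (WalkSeq.vertex W) (suc r)

  module _ where
    open WalkSeq

    nil : Fin m → WalkSeq x x 0
    nil {x = x} e₀ = record
      { vertex = λ _ → x ; edge = λ _ → e₀ ; start = refl ; finish = refl ; joins = λ () }

    cons : Joins G e x y → WalkSeq y z r → WalkSeq x z (suc r)
    cons {e = e} {x = x} j W = record
      { vertex = λ { zero → x ; (suc t) → vertex W t }
      ; edge   = λ { zero → e ; (suc t) → edge W t }
      ; start  = refl
      ; finish = finish W
      ; joins  = λ { {zero} _ → subst (Joins G e x) (sym (start W)) j
                   ; {suc t} t<r → joins W (s≤s⁻¹ t<r) }
      }

    -- e₀ only pads the edge sequence beyond the end of the walk.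
    fromWalk : Fin m → Walk G x y d → WalkSeq x y d
    fromWalk e₀ here             = nil e₀
    fromWalk e₀ (step (_ , j) w) = cons j (fromWalk e₀ w)

    take : ∀ t → t ≤ r → (W : WalkSeq x y r) → vertex W t ≡ y′ → WalkSeq x y′ t
    take t t≤r W eq = record
      { vertex = vertex W ; edge = edge W ; start = start W ; finish = eq
      ; joins = λ i<t → joins W (<-≤-trans i<t t≤r) }

    drop : ∀ t (W : WalkSeq x y (t + r)) → vertex W t ≡ x′ → WalkSeq x′ y r
    drop t W eq = record
      { vertex = λ i → vertex W (t + i)
      ; edge   = λ i → edge W (t + i)
      ; start  = trans (cong (vertex W) (+-identityʳ t)) eq
      ; finish = finish W
      ; joins  = λ {i} i<r → subst (Joins G (edge W (t + i)) (vertex W (t + i)) ∘ vertex W) (sym (+-suc t i))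
                               (joins W (+-monoʳ-< t i<r))
      }

    reverse : WalkSeq x y r → WalkSeq y x r
    reverse {r = r} W = record
      { vertex = λ t → vertex W (r ∸ t)
      ; edge   = λ t → edge W (r ∸ suc t)
      ; start  = finish W
      ; finish = trans (cong (vertex W) (n∸n≡0 r)) (start W)
      ; joins  = λ {t} t<r → subst (λ i → Joins G (edge W (r ∸ suc t)) (vertex W i) (vertex W (r ∸ suc t)))
                                   (sym (+-∸-assoc 1 t<r))
                                   (joins-sym (joins W (∸-monoʳ-< (s≤s z≤n) t<r)))
      }

    take-isPath : ∀ t (t≤r : t ≤ r) (W : WalkSeq x y r) (eq : vertex W t ≡ y′) →
                  IsPath W → IsPath (take t t≤r W eq)
    take-isPath t t≤r W eq inj i<1+t j<1+t = inj (<-≤-trans i<1+t (s≤s t≤r)) (<-≤-trans j<1+t (s≤s t≤r))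

    drop-isPath : ∀ t (W : WalkSeq x y (t + r)) (eq : vertex W t ≡ x′) →
                  IsPath W → IsPath (drop t W eq)
    drop-isPath {r = r} t W eq inj i<1+r j<1+r vi≡vj = +-cancelˡ-≡ t _ _ (inj (shift i<1+r) (shift j<1+r) vi≡vj)
      where
      shift : i < suc r → t + i < suc (t + r)
      shift {i} i<1+r = subst (t + i <_) (+-suc t r) (+-monoʳ-< t i<1+r)

    reverse-isPath : (W : WalkSeq x y r) → IsPath W → IsPath (reverse W)
    reverse-isPath {r = r} W inj {i} {j} (s≤s i≤r) (s≤s j≤r) vi≡vj =
      ∸-cancelˡ-≡ i≤r j≤r (inj (s≤s (m∸n≤m r i)) (s≤s (m∸n≤m r j)) vi≡vj)

    path-edge-injective : (W : WalkSeq x y r) → IsPath W → Injective< (edge W) r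
    path-edge-injective W inj {t} {u} t<r u<r et≡eu
      with joins-unique (joins W t<r) (subst (λ e → Joins G e _ _) (sym et≡eu) (joins W u<r))
    ... | inj₁ (vt≡vu , _)       = inj (m<n⇒m<1+n t<r) (m<n⇒m<1+n u<r) vt≡vu
    ... | inj₂ (vt≡v1+u , v1+t≡vu) =
      contradiction (≤-reflexive (inj (s≤s t<r) (m<n⇒m<1+n u<r) v1+t≡vu))
                    (<-asym (≤-reflexive (sym (inj (m<n⇒m<1+n t<r) (s≤s u<r) vt≡v1+u))))

    cutLoop : ∀ t c (W : WalkSeq x y (suc t + c + r)) → vertex W t ≡ vertex W (suc t + c) → WalkSeq x y (t + r)
    cutLoop {r = r} t c W loop = record
      { vertex = vertex′
      ; edge   = edge′
      ; start  = trans (vertex′-≤ z≤n) (start W)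
      ; finish = trans (vertex′-+ r) (finish W)
      ; joins  = joins′
      }
      where
      vertex′ : ℕ → Fin n
      vertex′ = append t (vertex W) (λ i → vertex W (suc t + c + i))
      edge′ : ℕ → Fin m
      edge′ = append t (edge W) (λ i → edge W (suc t + c + i))

      vertex′-+ : ∀ i → vertex′ (t + i) ≡ vertex W (suc t + c + i)
      vertex′-+ = append-+ t _ _

      vertex′-≤ : i ≤ t → vertex′ i ≡ vertex W i
      vertex′-≤ i≤t with m≤n⇒m<n∨m≡n i≤t
      ... | inj₁ i<t  = append-< _ _ i<t
      ... | inj₂ refl = begin
        vertex′ t                     ≡⟨ cong vertex′ (sym (+-identityʳ t)) ⟩
        vertex′ (t + 0)               ≡⟨ vertex′-+ 0 ⟩
        vertex W (suc t + c + 0)      ≡⟨ cong (vertex W) (+-identityʳ (suc t + c)) ⟩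
        vertex W (suc t + c)          ≡⟨ sym loop ⟩
        vertex W t                    ∎
        where open ≡-Reasoning

      joins′ : i < t + r → Joins G (edge′ i) (vertex′ i) (vertex′ (suc i))
      joins′ {i} i<t+r with split t i
      ... | below i<t = joins-resp (append-< _ _ i<t) (vertex′-≤ (<⇒≤ i<t)) (vertex′-≤ i<t)
                          (joins W (<-≤-trans i<t (≤-trans (m≤m+n t c) (m≤n⇒m≤1+n (m≤m+n (t + c) r)))))
      ... | above i′ = joins-resp (append-+ t _ _ i′) (vertex′-+ i′)
                          (trans (cong vertex′ (sym (+-suc t i′))) (trans (vertex′-+ (suc i′)) (cong (vertex W) (+-suc (suc t + c) i′))))
                          (joins W (+-monoʳ-< (suc t + c) (+-cancelˡ-< t i′ r i<t+r)))

    toPath : WalkSeq x y r → ∃[ r′ ] (r′ ≤ r × Σ[ P ∈ WalkSeq x y r′ ] IsPath P)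
    toPath W = go (<-wellFounded _) W
      where
      go : Acc _<_ r → (W : WalkSeq x y r) → ∃[ r′ ] (r′ ≤ r × Σ[ P ∈ WalkSeq x y r′ ] IsPath P)
      go {r = r} (acc rec) W with repetition? Finₚ._≟_ (vertex W) (suc r)
      ... | no none = r , ≤-refl , W , ¬repetition⇒injective (vertex W) none
      ... | yes (u , u<1+r , t , t<u , loop) with m≤n⇒∃[o]m+o≡n t<u
      ...   | c , refl with m≤n⇒∃[o]m+o≡n (s≤s⁻¹ u<1+r)
      ...     | r₀ , refl with go (rec (s≤s (+-monoˡ-≤ r₀ (m≤m+n t c)))) (cutLoop t c W loop)
      ...       | r′ , r′≤ , P = r′ , m≤n⇒m≤1+n (≤-trans r′≤ (+-monoˡ-≤ r₀ (m≤m+n t c))) , P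

  record CycleSeq (k : ℕ) : Set where
    field
      vertex           : ℕ → Fin n
      edge             : ℕ → Fin m
      closed           : vertex k ≡ vertex 0
      joins            : ∀ {i} → i < k → Joins G (edge i) (vertex i) (vertex (suc i))
      vertex-injective : Injective< vertex k
      edge-injective   : Injective< edge k

    OnCycle : Fin n → Set
    OnCycle v = ∃[ i ] (i < k × vertex i ≡ v)

    onCycle? : Decidable OnCycle
    onCycle? v = anyUpTo? (λ i → vertex i Finₚ.≟ v) k

  open CycleSeq using (OnCycle; onCycle?)

  fromCycle : Cycle G k → CycleSeq k
  fromCycle {zero}  C = contradiction (Cycle.pos C) λ ()
  fromCycle {suc k} C = record
    { vertex           = λ i → vert (clamp (suc k) i)
    ; edge             = λ i → edge (clamp k i)
    ; closed           = trans (cong vert (clamp-self (suc k))) (sym closed)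
    ; joins            = λ {i} i<1+k → joins-resp refl (cong vert (sym (inject₁-clamp (s≤s⁻¹ i<1+k)))) refl
                                         (edgeJoin (clamp k i))
    ; vertex-injective = λ {i} {j} i<1+k j<1+k vi≡vj →
        clamp-injective (s≤s⁻¹ i<1+k) (s≤s⁻¹ j<1+k)
          (vertInj (trans (cong vert (inject₁-clamp (s≤s⁻¹ i<1+k)))
                   (trans vi≡vj (cong vert (sym (inject₁-clamp (s≤s⁻¹ j<1+k)))))))
    ; edge-injective   = λ i<1+k j<1+k ei≡ej → clamp-injective (s≤s⁻¹ i<1+k) (s≤s⁻¹ j<1+k) (edgeInj ei≡ej)
    }
    where open Cycle C

  toCycle : 1 ≤ k → CycleSeq k → Cycle G k
  toCycle {k} 1≤k C = record
    { pos      = 1≤k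
    ; vert     = λ i → vertex (toℕ i)
    ; edge     = λ i → edge (toℕ i)
    ; closed   = sym (trans (cong vertex (Finₚ.toℕ-fromℕ k)) closed)
    ; vertInj  = λ {i} {j} vi≡vj → Finₚ.inject₁-injective (Finₚ.toℕ-injective
                   (vertex-injective (toℕ-inject₁< i) (toℕ-inject₁< j) vi≡vj))
    ; edgeInj  = λ {i} {j} ei≡ej → Finₚ.toℕ-injective (edge-injective (Finₚ.toℕ<n i) (Finₚ.toℕ<n j) ei≡ej)
    ; edgeJoin = λ i → joins-resp refl (cong vertex (Finₚ.toℕ-inject₁ i)) refl (joins (Finₚ.toℕ<n i))
    }
    where
    open CycleSeq C
    toℕ-inject₁< : (i : Fin k) → toℕ (inject₁ i) < k
    toℕ-inject₁< i = subst (_< k) (sym (Finₚ.toℕ-inject₁ i)) (Finₚ.toℕ<n i)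

  record Ear (C : CycleSeq k) (x y : Fin n) (s : ℕ) : Set where
    field
      walk     : WalkSeq x y s
      isPath   : IsPath walk
      interior : ∀ {t} → 0 < t → t < s → ¬ OnCycle C (WalkSeq.vertex walk t)

  module _ {C : CycleSeq k} where

    ear-reverse : Ear C x y s → Ear C y x s
    ear-reverse {s = s} ear = record
      { walk     = reverse walk
      ; isPath   = reverse-isPath walk isPath
      ; interior = λ 0<t t<s → interior (m<n⇒0<n∸m t<s) (∸-monoʳ-< 0<t (<⇒≤ t<s))
      }
      where open Ear ear

    ear-transfer : {C′ : CycleSeq k′} → (∀ {v} → OnCycle C′ v → OnCycle C v) → Ear C x y s → Ear C′ x y s
    ear-transfer C′⊆C ear = record
      { walk = walk ; isPath = isPath ; interior = λ 0<t t<s → interior 0<t t<s ∘ C′⊆C }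
      where open Ear ear

    ear-ends : (ear : Ear C x y s) → t ≤ s → OnCycle C (WalkSeq.vertex (Ear.walk ear) t) → t ≡ 0 ⊎ t ≡ s
    ear-ends {t = zero}  _   _   _  = inj₁ refl
    ear-ends {t = suc t} ear t<s on with m≤n⇒m<n∨m≡n t<s
    ... | inj₁ 1+t<s = contradiction on (Ear.interior ear (s≤s z≤n) 1+t<s)
    ... | inj₂ 1+t≡s = inj₂ 1+t≡s

    ends-on-cycle⇒single-edge : (ear : Ear C x y s) → t < s →
                                OnCycle C (WalkSeq.vertex (Ear.walk ear) t) →
                                OnCycle C (WalkSeq.vertex (Ear.walk ear) (suc t)) → t ≡ 0 × suc t ≡ s
    ends-on-cycle⇒single-edge ear t<s on₀ on₁ with ear-ends ear (<⇒≤ t<s) on₀ | ear-ends ear t<s on₁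
    ... | inj₁ t≡0 | inj₂ 1+t≡s = t≡0 , 1+t≡s
    ... | inj₂ t≡s | _          = contradiction t<s (<-irrefl t≡s)
    ... | inj₁ _   | inj₁ ()

  rotate : (C : CycleSeq k) → c + t ≡ k → 0 < t → CycleSeq k
  rotate {c = c} {t = t} C refl 0<t = record
    { vertex           = vertex′
    ; edge             = rotation c t edge
    ; closed           = closed′
    ; joins            = joins′
    ; vertex-injective = rotation-injective {c = c} {t = t} vertex vertex-injective
    ; edge-injective   = rotation-injective {c = c} {t = t} edge edge-injective
    }
    where
    open CycleSeq C
    open ≡-Reasoning
    vertex′ : ℕ → Fin n
    vertex′ = rotation c t vertex

    closed′ : vertex′ (c + t) ≡ vertex′ 0
    closed′ = begin
      vertex′ (c + t)  ≡⟨ cong vertex′ (+-comm c t) ⟩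
      vertex′ (t + c)  ≡⟨ append-+ t _ vertex c ⟩
      vertex c         ≡⟨ cong vertex (sym (+-identityʳ c)) ⟩
      vertex (c + 0)   ≡⟨ sym (append-< _ vertex 0<t) ⟩
      vertex′ 0        ∎

    vertex′-suc : i < t → vertex′ (suc i) ≡ vertex (suc (c + i))
    vertex′-suc {i} i<t with m≤n⇒m<n∨m≡n i<t
    ... | inj₁ 1+i<t = trans (append-< _ vertex 1+i<t) (cong vertex (+-suc c i))
    ... | inj₂ 1+i≡t = begin
      vertex′ (suc i)     ≡⟨ cong vertex′ (trans 1+i≡t (sym (+-identityʳ t))) ⟩
      vertex′ (t + 0)     ≡⟨ append-+ t _ vertex 0 ⟩
      vertex 0            ≡⟨ sym closed ⟩
      vertex (c + t)      ≡⟨ cong (λ z → vertex (c + z)) (sym 1+i≡t) ⟩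
      vertex (c + suc i)  ≡⟨ cong vertex (+-suc c i) ⟩
      vertex (suc (c + i)) ∎

    joins′ : i < c + t → Joins G (rotation c t edge i) (vertex′ i) (vertex′ (suc i))
    joins′ {i} i< with split t i
    ... | below i<t = joins-resp (append-< _ edge i<t) (append-< _ vertex i<t) (vertex′-suc i<t)
                        (joins (+-monoʳ-< c i<t))
    ... | above i′  = joins-resp (append-+ t _ edge i′) (append-+ t _ vertex i′)
                        (trans (cong vertex′ (sym (+-suc t i′))) (append-+ t _ vertex (suc i′)))
                        (joins (≤-<-trans (m≤n+m i′ t) i<))

  module _ (C : CycleSeq k) where
    open CycleSeq C using (vertex)

    rotate-vertex-< : (eq : c + t ≡ k) (0<t : 0 < t) → i < t →
                      CycleSeq.vertex (rotate C eq 0<t) i ≡ vertex (c + i)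
    rotate-vertex-< refl _ i<t = append-< _ vertex i<t

    rotate-vertex-+ : (eq : c + t ≡ k) (0<t : 0 < t) → ∀ i →
                      CycleSeq.vertex (rotate C eq 0<t) (t + i) ≡ vertex i
    rotate-vertex-+ {t = t} refl _ i = append-+ t _ vertex i

    rotate-onCycle : (eq : c + t ≡ k) (0<t : 0 < t) → OnCycle (rotate C eq 0<t) x → OnCycle C x
    rotate-onCycle {c = c} {t = t} refl _ (i , i< , vi≡x) with split t i
    ... | below i<t = c + i , +-monoʳ-< c i<t , trans (sym (append-< _ vertex i<t)) vi≡x
    ... | above i′  = i′ , ≤-<-trans (m≤n+m i′ t) i< , trans (sym (append-+ t _ vertex i′)) vi≡x

  -- The arc of C from 0 to b followed by the ear back to 0. The hypothesis s < b rules out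
  -- s = b = 1, where the ear could run back along the edge of the arc.
  module Closing {k b s} (C : CycleSeq k) (b<k : b < k) (s<b : s < b)
                 (ear : Ear C (CycleSeq.vertex C b) (CycleSeq.vertex C 0) s) where
    open CycleSeq C hiding (OnCycle; onCycle?)
    open Ear ear
    module Q = WalkSeq walk

    vertex′ : ℕ → Fin n
    vertex′ = append b vertex Q.vertex

    edge′ : ℕ → Fin m
    edge′ = append b edge Q.edge

    vertex′-+ : ∀ t → vertex′ (b + t) ≡ Q.vertex t
    vertex′-+ = append-+ b vertex Q.vertex

    vertex′-≤ : i ≤ b → vertex′ i ≡ vertex i
    vertex′-≤ i≤b with m≤n⇒m<n∨m≡n i≤b
    ... | inj₁ i<b  = append-< vertex _ i<b
    ... | inj₂ refl = trans (cong vertex′ (sym (+-identityʳ b))) (trans (vertex′-+ 0) Q.start)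

    joins′ : i < b + s → Joins G (edge′ i) (vertex′ i) (vertex′ (suc i))
    joins′ {i} i< with split b i
    ... | below i<b = joins-resp (append-< edge _ i<b) (vertex′-≤ (<⇒≤ i<b)) (vertex′-≤ i<b)
                        (joins (<-trans i<b b<k))
    ... | above t   = joins-resp (append-+ b edge _ t) (vertex′-+ t)
                        (trans (cong vertex′ (sym (+-suc b t))) (vertex′-+ (suc t)))
                        (Q.joins (+-cancelˡ-< b t s i<))

    arc≢ear-vertex : ∀ {i t} → i < b → t < s → vertex i ≢ Q.vertex t
    arc≢ear-vertex {t = zero}  i<b _   vi≡q0 = <-irrefl (vertex-injective (<-trans i<b b<k) b<k (trans vi≡q0 Q.start)) i<b
    arc≢ear-vertex {t = suc _} i<b t<s vi≡qt = interior (s≤s z≤n) t<s (_ , <-trans i<b b<k , vi≡qt)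

    arc≢ear-edge : ∀ {i t} → i < b → t < s → edge i ≢ Q.edge t
    arc≢ear-edge {i} {t} i<b t<s ei≡et =
      shared-ends (joins-unique (joins i<k) (subst (λ e → Joins G e _ _) (sym ei≡et) (Q.joins t<s)))
      where
      i<k : i < k
      i<k = <-trans i<b b<k
      1+i<k : suc i < k
      1+i<k = ≤-trans (s≤s i<b) b<k
      shared-ends : (vertex i ≡ Q.vertex t × vertex (suc i) ≡ Q.vertex (suc t))
                  ⊎ (vertex i ≡ Q.vertex (suc t) × vertex (suc i) ≡ Q.vertex t) → ⊥
      shared-ends (inj₁ (vi≡qt , v1+i≡q1+t)) with ends-on-cycle⇒single-edge ear t<s (_ , i<k , vi≡qt) (_ , 1+i<k , v1+i≡q1+t)
      ... | t≡0 , _ = <-irrefl (vertex-injective i<k b<k (trans vi≡qt (trans (cong Q.vertex t≡0) Q.start))) i<b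
      shared-ends (inj₂ (vi≡q1+t , v1+i≡qt)) with ends-on-cycle⇒single-edge ear t<s (_ , 1+i<k , v1+i≡qt) (_ , i<k , vi≡q1+t)
      ... | t≡0 , 1+t≡s = <-irrefl (sym b≡s) s<b
        where
        i≡0 : i ≡ 0
        i≡0 = vertex-injective i<k (≤-<-trans z≤n b<k) (trans vi≡q1+t (trans (cong Q.vertex 1+t≡s) Q.finish))
        1+i≡b : suc i ≡ b
        1+i≡b = vertex-injective 1+i<k b<k (trans v1+i≡qt (trans (cong Q.vertex t≡0) Q.start))
        b≡s : b ≡ s
        b≡s = trans (sym 1+i≡b) (trans (cong suc (trans i≡0 (sym t≡0))) 1+t≡s)

    vertex′-injective : Injective< vertex′ (b + s)
    vertex′-injective {i} {j} i< j< eq with split b i | split b j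
    ... | below i<b | below j<b = vertex-injective (<-trans i<b b<k) (<-trans j<b b<k)
                                    (trans (sym (vertex′-≤ (<⇒≤ i<b))) (trans eq (vertex′-≤ (<⇒≤ j<b))))
    ... | below i<b | above t   = contradiction (trans (sym (vertex′-≤ (<⇒≤ i<b))) (trans eq (vertex′-+ t)))
                                    (arc≢ear-vertex i<b (+-cancelˡ-< b t s j<))
    ... | above t   | below j<b = contradiction (trans (sym (vertex′-≤ (<⇒≤ j<b))) (trans (sym eq) (vertex′-+ t)))
                                    (arc≢ear-vertex j<b (+-cancelˡ-< b t s i<))
    ... | above t   | above t′  = cong (b +_) (isPath (m<n⇒m<1+n (+-cancelˡ-< b t s i<)) (m<n⇒m<1+n (+-cancelˡ-< b t′ s j<))
                                    (trans (sym (vertex′-+ t)) (trans eq (vertex′-+ t′))))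

    edge′-injective : Injective< edge′ (b + s)
    edge′-injective {i} {j} i< j< eq with split b i | split b j
    ... | below i<b | below j<b = edge-injective (<-trans i<b b<k) (<-trans j<b b<k)
                                    (trans (sym (append-< edge _ i<b)) (trans eq (append-< edge _ j<b)))
    ... | below i<b | above t   = contradiction (trans (sym (append-< edge _ i<b)) (trans eq (append-+ b edge _ t)))
                                    (arc≢ear-edge i<b (+-cancelˡ-< b t s j<))
    ... | above t   | below j<b = contradiction (trans (sym (append-< edge _ j<b)) (trans (sym eq) (append-+ b edge _ t)))
                                    (arc≢ear-edge j<b (+-cancelˡ-< b t s i<))
    ... | above t   | above t′  = cong (b +_) (path-edge-injective walk isPath (+-cancelˡ-< b t s i<) (+-cancelˡ-< b t′ s j<)
                                    (trans (sym (append-+ b edge _ t)) (trans eq (append-+ b edge _ t′))))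

    cycle : CycleSeq (b + s)
    cycle = record
      { vertex           = vertex′
      ; edge             = edge′
      ; closed           = trans (vertex′-+ s) (trans Q.finish (sym (vertex′-≤ z≤n)))
      ; joins            = joins′
      ; vertex-injective = vertex′-injective
      ; edge-injective   = edge′-injective
      }

  close-rotated : (C : CycleSeq k) (eq : c + t ≡ k) (0<t : 0 < t) → b < k → s < b →
                  CycleSeq.vertex (rotate C eq 0<t) b ≡ x → Ear C x (CycleSeq.vertex C c) s → CycleSeq (b + s)
  close-rotated {c = c} {s = s} C eq 0<t b<k s<b vb≡x ear =
    Closing.cycle (rotate C eq 0<t) b<k s<b
      (subst₂ (λ x y → Ear (rotate C eq 0<t) x y s) (sym vb≡x) (sym v0≡vc) (ear-transfer (rotate-onCycle C eq 0<t) ear))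
    where
    v0≡vc : CycleSeq.vertex (rotate C eq 0<t) 0 ≡ CycleSeq.vertex C c
    v0≡vc = trans (rotate-vertex-< C eq 0<t 0<t) (cong (CycleSeq.vertex C) (+-identityʳ c))

  shortcut⇒cycle : ℓ + ℓ ≤ k → (C : CycleSeq k) → b < k → Shortcut k s a b →
                   Ear C (CycleSeq.vertex C a) (CycleSeq.vertex C b) s → ∃[ L ] (ℓ ≤ L × L < k × CycleSeq L)
  shortcut⇒cycle {ℓ} {k} {b} {s} {a} ℓ+ℓ≤k C b<k shortcut ear
    with m≤n⇒∃[o]m+o≡n (≤-trans (m≤n+m a s) (<⇒≤ (proj₁ shortcut))) | m<n⇒∃[o]0<o×m+o≡n b<k
  ... | d , a+d≡b | t , 0<t , b+t≡k with shortcut-arcs a+d≡b b+t≡k shortcut | ℓ ≤? d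
  ... | (s<d , d+s<k) , _ | yes ℓ≤d =
    d + s , ≤-trans ℓ≤d (m≤m+n d s) , d+s<k ,
    close-rotated {c = a} C a+[d+t]≡k 0<d+t (≤-<-trans (m≤m+n d s) d+s<k) s<d vd≡vb (ear-reverse ear)
    where
    a+[d+t]≡k : a + (d + t) ≡ k
    a+[d+t]≡k = trans (sym (+-assoc a d t)) (trans (cong (_+ t) a+d≡b) b+t≡k)
    0<d+t : 0 < d + t
    0<d+t = <-≤-trans 0<t (m≤n+m t d)
    vd≡vb : CycleSeq.vertex (rotate {c = a} C a+[d+t]≡k 0<d+t) d ≡ CycleSeq.vertex C b
    vd≡vb = trans (rotate-vertex-< C {c = a} a+[d+t]≡k 0<d+t (m<m+n d 0<t)) (cong (CycleSeq.vertex C) a+d≡b)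
  ... | _ , (s<t+a , t+a+s<k) | no ℓ≰d =
    t + a + s , ≤-trans (long-arc {a = a} {d = d} ℓ+ℓ≤a+d+t (≰⇒> ℓ≰d)) (m≤m+n (t + a) s) , t+a+s<k ,
    close-rotated {c = b} C b+t≡k 0<t (≤-<-trans (m≤m+n (t + a) s) t+a+s<k) s<t+a
      (rotate-vertex-+ C {c = b} b+t≡k 0<t a) ear
    where
    ℓ+ℓ≤a+d+t : ℓ + ℓ ≤ a + d + t
    ℓ+ℓ≤a+d+t = subst (ℓ + ℓ ≤_) (sym (trans (cong (_+ t) a+d≡b) b+t≡k)) ℓ+ℓ≤k

  module _ (C : CycleSeq k) (j<k : j < k) (j+j≤k : j + j ≤ k) where
    open CycleSeq C hiding (OnCycle; onCycle?)

    first-return : (P : WalkSeq x y r) → IsPath P → u < r → vertex b ≡ WalkSeq.vertex P (suc u) →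
                   (∀ {t} → t < u → ¬ OnCycle C (WalkSeq.vertex P (suc t))) → Ear C x (vertex b) (suc u)
    first-return {u = u} P isPath u<r vb≡pu before = record
      { walk     = take (suc u) u<r P (sym vb≡pu)
      ; isPath   = take-isPath (suc u) u<r P (sym vb≡pu) isPath
      ; interior = λ { {suc t} _ 1+t<1+u → before (s≤s⁻¹ 1+t<1+u) }
      }

    find-shortcut : Acc _<_ r → a < k → (P : WalkSeq (vertex a) (vertex j) r) → IsPath P → Lagging k j a r →
                    ∃[ a ] ∃[ b ] ∃[ s ] (b < k × Shortcut k s a b × Ear C (vertex a) (vertex b) s)
    find-shortcut {zero} {a} _ a<k P _ lag =
      ⊥-elim (¬lagging-at-target j+j≤k (subst (λ a → Lagging k j a 0) a≡j lag))
      where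
      a≡j : a ≡ j
      a≡j = vertex-injective a<k j<k (trans (sym (WalkSeq.start P)) (WalkSeq.finish P))
    find-shortcut {suc r} {a} (acc rec) a<k P isPath lag
      with least (λ u → onCycle? C (WalkSeq.vertex P (suc u))) (suc r) (r , ≤-refl , j , j<k , sym (WalkSeq.finish P))
    ... | u , u<1+r , (b , b<k , vb≡pu) , before
      with shortcut? k (suc u) a b | shortcut? k (suc u) b a | m≤n⇒∃[o]m+o≡n (s≤s⁻¹ u<1+r)
    ... | yes ab   | _        | _ = a , b , suc u , b<k , ab , first-return P isPath u<1+r vb≡pu before
    ... | no _     | yes ba   | _ = b , a , suc u , a<k , ba , ear-reverse (first-return P isPath u<1+r vb≡pu before)
    ... | no ¬ab   | no ¬ba   | r′ , refl =
      find-shortcut (rec (s≤s (m≤n+m r′ u))) b<k (drop (suc u) P (sym vb≡pu))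
        (drop-isPath (suc u) P (sym vb≡pu) isPath) (lagging-step a<k ¬ab ¬ba lag)

  shorter-cycle : ℓ + ℓ ≤ k → (C : CycleSeq k) → j + j ≤ k → j < k → d < j →
                  Walk G (CycleSeq.vertex C 0) (CycleSeq.vertex C j) d → ∃[ L ] (ℓ ≤ L × L < k × CycleSeq L)
  shorter-cycle ℓ+ℓ≤k C j+j≤k j<k d<j w with toPath (fromWalk (CycleSeq.edge C 0) w)
  ... | r , r≤d , P , isPath
    with find-shortcut C j<k j+j≤k (<-wellFounded r) (≤-<-trans z≤n j<k) P isPath (inj₁ (≤-<-trans r≤d d<j))
  ... | _ , _ , _ , b<k , shortcut , ear = shortcut⇒cycle ℓ+ℓ≤k C b<k shortcut ear

no-long-cycle : (G : Multigraph) → 1 ≤ ℓ → ℓ + ℓ ≤ suc g → DiameterLessThanHalf G g →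
                (∀ k → Cycle G k → k < ℓ ⊎ g < k) → CycleSeq G k → g < k → ⊥
no-long-cycle {ℓ} {g} G 1≤ℓ ℓ+ℓ≤1+g diam cycles = go (<-wellFounded _)
  where
  go : ∀ {k} → Acc _<_ k → CycleSeq G k → g < k → ⊥
  go {suc k} (acc rec) C g<k with diam (CycleSeq.vertex C 0) (CycleSeq.vertex C ⌊ suc k /2⌋)
  ... | d , w , d+d<g
    with shorter-cycle G (≤-trans ℓ+ℓ≤1+g g<k) C (⌊n/2⌋+⌊n/2⌋≤n (suc k)) (⌊n/2⌋<n k)
           (<-≤-trans (m+m<n⇒m<⌊1+n/2⌋ d+d<g) (⌊n/2⌋-mono g<k)) w
  ... | L , ℓ≤L , L<k , C′ with cycles L (toCycle G (≤-trans 1≤ℓ ℓ≤L) C′)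
  ...   | inj₁ L<ℓ = <-irrefl refl (<-≤-trans L<ℓ ℓ≤L)
  ...   | inj₂ g<L = go (rec L<k) C′ g<L

lemma6 : (ℓ g : ℕ) → 1 ≤ ℓ → 1 ≤ g → 2 * ℓ ≤ g + 1 →
         (G : Multigraph) → DiameterLessThanHalf G g →
         (∀ k → Cycle G k → k < ℓ ⊎ g < k) →
         ∀ k → Cycle G k → k < ℓ
lemma6 ℓ g 1≤ℓ _ 2ℓ≤g+1 G diam cycles k C with cycles k C
... | inj₁ k<ℓ = k<ℓ
... | inj₂ g<k = ⊥-elim (no-long-cycle G 1≤ℓ ℓ+ℓ≤1+g diam cycles (fromCycle G C) g<k)
  where
  ℓ+ℓ≤1+g : ℓ + ℓ ≤ suc g
  ℓ+ℓ≤1+g = subst₂ _≤_ (cong (ℓ +_) (+-identityʳ ℓ)) (+-comm g 1) 2ℓ≤g+1
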